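{- Let $E$ be a finite set of $n$ points in $\mathbb{R}^3$ (with $n$ large). Then the number of tuples $(x_1,\dots,x_5)\in E^5$ with $\angle(x_j,x_{j+1},x_{j+2})=\pi/2$ for $j=1,2,3$ is $\lesssim n^4$.
   Context: $\angle(x,y,z)\in[0,\pi]$ denotes the angle at $y$ between $x-y$ and $z-y$ (for $x\ne y\ne z$). $X\lesssim Y$ means $X\le CY$ for all $n>N$ with constants $C,N$ independent of $n$. -}

module Defs where

open import Level using (0ℓ)
open import Data.Product using (Σ; ∃; _×_; _,_)
open import Data.Sum using (_⊎_)
open import Data.Fin using (Fin)
open import Data.Vec using (Vec; []; _∷_)
open import Relation.Nullary using (¬_)
open import Relation.Binary.PropositionalEquality using (_≡_)
open import Relation.Binary.Structures using (IsStrictTotalOrder)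
open import Algebra.Structures using (IsCommutativeRing)

-- A (Dedekind-)complete ordered field, i.e. the real numbers, axiomatised
-- (unique up to isomorphism).  Equality is propositional equality.
record RealField : Set₁ where
  infixl 6 _+_
  infixl 7 _*_
  infix 4 _<_ _≤_
  field
    Carrier : Set
    _+_ _*_ : Carrier → Carrier → Carrier
    -_      : Carrier → Carrier
    0# 1#   : Carrier
    _<_     : Carrier → Carrier → Set
    isCommutativeRing : IsCommutativeRing _≡_ _+_ _*_ -_ 0# 1#
    0≢1     : ¬ (0# ≡ 1#)
    inverse : ∀ x → ¬ (x ≡ 0#) → ∃ λ y → x * y ≡ 1#
    isStrictTotalOrder : IsStrictTotalOrder _≡_ _<_
    +-mono-< : ∀ {x y} z → x < y → x + z < y + z
    *-pos    : ∀ {x y} → 0# < x → 0# < y → 0# < x * y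

  _≤_ : Carrier → Carrier → Set
  x ≤ y = x < y ⊎ x ≡ y

  IsUpperBound : (Carrier → Set) → Carrier → Set
  IsUpperBound P b = ∀ x → P x → x ≤ b

  field
    complete : (P : Carrier → Set) → ∃ P → ∃ (IsUpperBound P) →
               ∃ λ s → IsUpperBound P s × (∀ b → IsUpperBound P b → s ≤ b)

  _-_ : Carrier → Carrier → Carrier
  x - y = x + (- y)

module Geometry (R : RealField) where
  open RealField R

  Point : Set
  Point = Carrier × Carrier × Carrier

  _−ᵖ_ : Point → Point → Point
  (a₁ , a₂ , a₃) −ᵖ (b₁ , b₂ , b₃) = (a₁ - b₁ , a₂ - b₂ , a₃ - b₃)

  dot : Point → Point → Carrier
  dot (a₁ , a₂ , a₃) (b₁ , b₂ , b₃) = a₁ * b₁ + a₂ * b₂ + a₃ * b₃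

  -- ∠(x,y,z) = π/2 : x ≠ y ≠ z and cos ∠ = (x−y)·(z−y)/(|x−y||z−y|) = 0
  RightAngle : Point → Point → Point → Set
  RightAngle x y z = ¬ (x ≡ y) × ¬ (z ≡ y) × dot (x −ᵖ y) (z −ᵖ y) ≡ 0#

  RightChain : Vec Point 5 → Set
  RightChain (a ∷ b ∷ c ∷ d ∷ e ∷ []) =
    RightAngle a b c × RightAngle b c d × RightAngle c d e

{-# OPTIONS --safe #-}
module Submission where

-- Write a chain as (a, b, c, d, e) and let n = (e − d) × (a − b).  If n = 0, then e − d is
-- parallel to a − b, so d is the foot of the perpendicular from c to the line through e in
-- direction a − b: the chain is determined by (a, b, c, e).  If n ≠ 0, the conditions at b and
-- d put c on the line {x : (a − b)·x = (a − b)·b, (e − d)·x = (e − d)·d} of direction n, and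
-- the condition at c puts it on the sphere with diameter bd.  A line meets a sphere in at most
-- two points, and here they are mirror images in the plane through the midpoint of bd normal
-- to n, so the chain is determined by (a, b, d, e) and the side of that plane containing c.
-- Hence the chains inject into {0, 1, 2} × E⁴.

open import Defs
open import Level using (0ℓ)
open import Data.Nat as ℕ using (ℕ; zero; suc)
import Data.Nat.Properties as ℕₚ
open import Data.Integer as ℤ using (ℤ; -[1+_]; _⊖_; _◃_; sign; ∣_∣)
open import Data.Integer.Properties using ([1+m]⊖[1+n]≡m⊖n)
open import Data.Sign as Sign using (Sign)
open import Data.Maybe as Maybe using (Maybe)
open import Data.Product using (_×_; _,_; proj₁; proj₂)
open import Data.Product.Properties using (≡-dec)
open import Data.Vec using (Vec; []; _∷_; map)
open import Data.Sum using (inj₁; inj₂)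
open import Data.Empty using (⊥-elim)
open import Function using (_∘_; _⇔_; mk⇔; Equivalence)
open import Relation.Nullary using (¬_; Dec; yes; no; contradiction)
open import Relation.Nullary.Decidable using (dec⇒maybe)
open import Relation.Binary.Definitions using (DecidableEquality; tri<; tri≈; tri>)
open import Relation.Binary.Structures using (IsStrictTotalOrder)
open import Relation.Binary.PropositionalEquality
open import Algebra.Bundles using (CommutativeRing)
open import Algebra.Solver.Ring.AlmostCommutativeRing
  using (fromCommutativeRing; _-Raw-AlmostCommutative⟶_)

module Scalars (R : RealField) where
  open RealField R
  open IsStrictTotalOrder isStrictTotalOrder using (compare; irrefl; asym; _≟_) renaming (trans to <-trans)
  open ≡-Reasoning

  commutativeRing : CommutativeRing 0ℓ 0ℓ
  commutativeRing = record { isCommutativeRing = isCommutativeRing }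

  open CommutativeRing commutativeRing
    using ( semiring; ring; +-group; +-abelianGroup; +-commutativeSemigroup
          ; +-comm; +-identityˡ; +-identityʳ; -‿inverseʳ; zeroˡ; *-identityʳ )
  open import Algebra.Properties.Semiring.Mult semiring using (×-homo-+; ×1-homo-*)
    renaming (_×_ to _×′_)
  open import Algebra.Properties.Ring ring using (-0#≈0#; -‿involutive; -‿distribˡ-*; -‿distribʳ-*)
  open import Algebra.Properties.AbelianGroup +-abelianGroup using (⁻¹-∙-comm)
  open import Algebra.Properties.CommutativeSemigroup +-commutativeSemigroup using (interchange)
  open import Algebra.Properties.Group +-group public using (x∙y⁻¹≈ε⇒x≈y; x≈y⇒x∙y⁻¹≈ε)

  -- The solver needs coefficients whose equality computes; the field's own _≟_ does not.
  fromℤ : ℤ → Carrier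
  fromℤ (ℤ.+ n)    = n ×′ 1#
  fromℤ -[1+ n ]  = - (suc n ×′ 1#)

  [1+x]-[1+y]≡x-y : ∀ x y → (1# + x) - (1# + y) ≡ x - y
  [1+x]-[1+y]≡x-y x y = begin
    (1# + x) + - (1# + y)    ≡⟨ cong ((1# + x) +_) (⁻¹-∙-comm 1# y) ⟨
    (1# + x) + (- 1# + - y)  ≡⟨ interchange 1# x (- 1#) (- y) ⟩
    (1# + - 1#) + (x + - y)  ≡⟨ cong (_+ (x - y)) (-‿inverseʳ 1#) ⟩
    0# + (x - y)             ≡⟨ +-identityˡ (x - y) ⟩
    x - y                    ∎

  fromℤ-⊖ : ∀ m n → fromℤ (m ⊖ n) ≡ (m ×′ 1#) - (n ×′ 1#)
  fromℤ-⊖ m       zero    = sym (trans (cong (m ×′ 1# +_) -0#≈0#) (+-identityʳ (m ×′ 1#)))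
  fromℤ-⊖ zero    (suc n) = sym (+-identityˡ _)
  fromℤ-⊖ (suc m) (suc n) = begin
    fromℤ (suc m ⊖ suc n)          ≡⟨ cong fromℤ ([1+m]⊖[1+n]≡m⊖n m n) ⟩
    fromℤ (m ⊖ n)                  ≡⟨ fromℤ-⊖ m n ⟩
    (m ×′ 1#) - (n ×′ 1#)          ≡⟨ [1+x]-[1+y]≡x-y (m ×′ 1#) (n ×′ 1#) ⟨
    (suc m ×′ 1#) - (suc n ×′ 1#)  ∎

  fromℤ-+ : ∀ i j → fromℤ (i ℤ.+ j) ≡ fromℤ i + fromℤ j
  fromℤ-+ -[1+ m ] -[1+ n ] = begin
    - (suc (suc (m ℕ.+ n)) ×′ 1#)    ≡⟨ cong (λ k → - (suc k ×′ 1#)) (ℕₚ.+-suc m n) ⟨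
    - ((suc m ℕ.+ suc n) ×′ 1#)      ≡⟨ cong -_ (×-homo-+ 1# (suc m) (suc n)) ⟩
    - (suc m ×′ 1# + suc n ×′ 1#)    ≡⟨ ⁻¹-∙-comm _ _ ⟨
    fromℤ -[1+ m ] + fromℤ -[1+ n ]  ∎
  fromℤ-+ -[1+ m ] (ℤ.+ n)  = trans (fromℤ-⊖ n (suc m)) (+-comm _ _)
  fromℤ-+ (ℤ.+ m)  -[1+ n ] = fromℤ-⊖ m (suc n)
  fromℤ-+ (ℤ.+ m)  (ℤ.+ n)  = ×-homo-+ 1# m n

  signed : Sign → Carrier → Carrier
  signed Sign.+ x = x
  signed Sign.- x = - x

  fromℤ-◃ : ∀ s n → fromℤ (s ◃ n) ≡ signed s (n ×′ 1#)
  fromℤ-◃ Sign.+ zero    = refl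
  fromℤ-◃ Sign.- zero    = sym -0#≈0#
  fromℤ-◃ Sign.+ (suc n) = refl
  fromℤ-◃ Sign.- (suc n) = refl

  fromℤ≡signed : ∀ i → fromℤ i ≡ signed (sign i) (∣ i ∣ ×′ 1#)
  fromℤ≡signed (ℤ.+ n)    = refl
  fromℤ≡signed -[1+ n ]  = refl

  -x*-y≡x*y : ∀ x y → - x * - y ≡ x * y
  -x*-y≡x*y x y = begin
    - x * - y      ≡⟨ -‿distribˡ-* x (- y) ⟨
    - (x * - y)    ≡⟨ cong -_ (-‿distribʳ-* x y) ⟨
    - - (x * y)    ≡⟨ -‿involutive (x * y) ⟩
    x * y          ∎

  signed-* : ∀ s t x y → signed s x * signed t y ≡ signed (s Sign.* t) (x * y)
  signed-* Sign.+ Sign.+ x y = refl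
  signed-* Sign.+ Sign.- x y = sym (-‿distribʳ-* x y)
  signed-* Sign.- Sign.+ x y = sym (-‿distribˡ-* x y)
  signed-* Sign.- Sign.- x y = -x*-y≡x*y x y

  fromℤ-* : ∀ i j → fromℤ (i ℤ.* j) ≡ fromℤ i * fromℤ j
  fromℤ-* i j = begin
    fromℤ (i ℤ.* j)                        ≡⟨ fromℤ-◃ σ (∣ i ∣ ℕ.* ∣ j ∣) ⟩
    signed σ ((∣ i ∣ ℕ.* ∣ j ∣) ×′ 1#)     ≡⟨ cong (signed σ) (×1-homo-* ∣ i ∣ ∣ j ∣) ⟩
    signed σ (x * y)                       ≡⟨ signed-* (sign i) (sign j) x y ⟨
    signed (sign i) x * signed (sign j) y  ≡⟨ cong₂ _*_ (fromℤ≡signed i) (fromℤ≡signed j) ⟨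
    fromℤ i * fromℤ j                      ∎
    where
    σ : Sign
    σ = sign i Sign.* sign j
    x y : Carrier
    x = ∣ i ∣ ×′ 1#
    y = ∣ j ∣ ×′ 1#

  fromℤ-neg : ∀ i → fromℤ (ℤ.- i) ≡ - fromℤ i
  fromℤ-neg (ℤ.+ zero)    = sym -0#≈0#
  fromℤ-neg (ℤ.+ (suc n)) = refl
  fromℤ-neg -[1+ n ]      = sym (-‿involutive _)

  fromℤ-homomorphism : ℤ.+-*-rawRing -Raw-AlmostCommutative⟶ fromCommutativeRing commutativeRing
  fromℤ-homomorphism = record
    { ⟦_⟧    = fromℤ
    ; +-homo = fromℤ-+
    ; *-homo = fromℤ-*
    ; -‿homo = fromℤ-neg
    ; 0-homo = refl
    ; 1-homo = +-identityʳ 1#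
    }

  fromℤ-≟ : ∀ i j → Maybe (fromℤ i ≡ fromℤ j)
  fromℤ-≟ i j = Maybe.map (cong fromℤ) (dec⇒maybe (i ℤ.≟ j))

  open import Algebra.Solver.Ring ℤ.+-*-rawRing (fromCommutativeRing commutativeRing)
    fromℤ-homomorphism fromℤ-≟ public using (solve; _:=_; _:+_; _:*_; :-_; _:-_; Polynomial)

  x*y≡0⇒y≡0 : ∀ {x y} → ¬ x ≡ 0# → x * y ≡ 0# → y ≡ 0#
  x*y≡0⇒y≡0 {x} {y} x≢0 xy≡0 with inverse x x≢0
  ... | x⁻¹ , xx⁻¹≡1 = begin
    y              ≡⟨ *-identityʳ y ⟨
    y * 1#         ≡⟨ cong (y *_) xx⁻¹≡1 ⟨
    y * (x * x⁻¹)  ≡⟨ solve 3 (λ x y x⁻¹ → y :* (x :* x⁻¹) := (x :* y) :* x⁻¹) refl x y x⁻¹ ⟩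
    (x * y) * x⁻¹  ≡⟨ cong (_* x⁻¹) xy≡0 ⟩
    0# * x⁻¹       ≡⟨ zeroˡ x⁻¹ ⟩
    0#             ∎

  *-cancelˡ-≢0 : ∀ {x y z} → ¬ x ≡ 0# → x * y ≡ x * z → y ≡ z
  *-cancelˡ-≢0 {x} {y} {z} x≢0 xy≡xz = x∙y⁻¹≈ε⇒x≈y y z (x*y≡0⇒y≡0 x≢0 (begin
    x * (y - z)        ≡⟨ solve 3 (λ x y z → x :* (y :- z) := x :* y :- x :* z) refl x y z ⟩
    (x * y) - (x * z)  ≡⟨ x≈y⇒x∙y⁻¹≈ε xy≡xz ⟩
    0#                 ∎))

  x*x≡0⇒x≡0 : ∀ {x} → x * x ≡ 0# → x ≡ 0#
  x*x≡0⇒x≡0 {x} xx≡0 with x ≟ 0#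
  ... | yes x≡0 = x≡0
  ... | no  x≢0 = x*y≡0⇒y≡0 x≢0 xx≡0

  +-monoˡ-< : ∀ {x y} z → x < y → z + x < z + y
  +-monoˡ-< {x} {y} z x<y = subst₂ _<_ (+-comm x z) (+-comm y z) (+-mono-< z x<y)

  0<+ : ∀ {x y} → 0# < x → 0# ≤ y → 0# < x + y
  0<+ {x} 0<x (inj₂ refl) = subst (0# <_) (sym (+-identityʳ x)) 0<x
  0<+ {x} {y} 0<x (inj₁ 0<y) = <-trans 0<y (subst (_< x + y) (+-identityˡ y) (+-mono-< y 0<x))

  0≤+ : ∀ {x y} → 0# ≤ x → 0# ≤ y → 0# ≤ x + y
  0≤+ (inj₁ 0<x) 0≤y = inj₁ (0<+ 0<x 0≤y)
  0≤+ {y = y} (inj₂ refl) 0≤y = subst (0# ≤_) (sym (+-identityˡ y)) 0≤y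

  x<0⇒0<-x : ∀ {x} → x < 0# → 0# < - x
  x<0⇒0<-x {x} x<0 = subst₂ _<_ (-‿inverseʳ x) (+-identityˡ (- x)) (+-mono-< (- x) x<0)

  0≤x*x : ∀ x → 0# ≤ x * x
  0≤x*x x with compare x 0#
  ... | tri< x<0 _ _ = inj₁ (subst (0# <_) (-x*-y≡x*y x x) (*-pos (x<0⇒0<-x x<0) (x<0⇒0<-x x<0)))
  ... | tri≈ _ refl _ = inj₂ (sym (zeroˡ 0#))
  ... | tri> _ _ 0<x = inj₁ (*-pos 0<x 0<x)

  x+y≡0⇒x≡0 : ∀ {x y} → 0# ≤ x → 0# ≤ y → x + y ≡ 0# → x ≡ 0#
  x+y≡0⇒x≡0 (inj₂ 0≡x) _ _ = sym 0≡x
  x+y≡0⇒x≡0 (inj₁ 0<x) 0≤y x+y≡0 = ⊥-elim (irrefl refl (subst (0# <_) x+y≡0 (0<+ 0<x 0≤y)))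

  x+y≡0⇒y≡0 : ∀ {x y} → 0# ≤ x → 0# ≤ y → x + y ≡ 0# → y ≡ 0#
  x+y≡0⇒y≡0 {x} {y} 0≤x 0≤y x+y≡0 = x+y≡0⇒x≡0 0≤y 0≤x (trans (+-comm y x) x+y≡0)

  -- When p + p′ = q, comparing 2p with q is comparing p with p′.
  mirror-below : ∀ {p p′ q} → p + p′ ≡ q → ¬ p ≡ p′ → (p + p < q) ⇔ (¬ p′ + p′ < q)
  mirror-below {p} {p′} {q} p+p′≡q p≢p′ = mk⇔ to from
    where
    p′+p≡q : p′ + p ≡ q
    p′+p≡q = trans (+-comm p′ p) p+p′≡q

    to : p + p < q → ¬ p′ + p′ < q
    to p+p<q p′+p′<q with compare p p′
    ... | tri< p<p′ _ _ = asym p′+p′<q (subst (_< p′ + p′) p+p′≡q (+-mono-< p′ p<p′))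
    ... | tri≈ _ p≡p′ _ = p≢p′ p≡p′
    ... | tri> _ _ p′<p = asym p+p<q (subst (_< p + p) p′+p≡q (+-mono-< p p′<p))

    from : ¬ p′ + p′ < q → p + p < q
    from p′+p′≮q with compare p p′
    ... | tri< p<p′ _ _ = subst (p + p <_) p+p′≡q (+-monoˡ-< p p<p′)
    ... | tri≈ _ p≡p′ _ = contradiction p≡p′ p≢p′
    ... | tri> _ _ p′<p = contradiction (subst (p′ + p′ <_) p′+p≡q (+-monoˡ-< p′ p′<p)) p′+p′≮q

-- At the field this reproduces Geometry's dot and _−ᵖ_ definitionally, so at solver polynomials
-- it turns vector identities into ring identities between components.
module TripleOps {A : Set} (_+_ _*_ : A → A → A) (-_ : A → A) where
  _−ᵖ_ _+ᵥ_ : A × A × A → A × A × A → A × A × A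
  (a₁ , a₂ , a₃) −ᵖ (b₁ , b₂ , b₃) = (a₁ + (- b₁) , a₂ + (- b₂) , a₃ + (- b₃))
  (a₁ , a₂ , a₃) +ᵥ (b₁ , b₂ , b₃) = (a₁ + b₁ , a₂ + b₂ , a₃ + b₃)

  _·ᵥ_ : A → A × A × A → A × A × A
  k ·ᵥ (a₁ , a₂ , a₃) = (k * a₁ , k * a₂ , k * a₃)

  dot : A × A × A → A × A × A → A
  dot (a₁ , a₂ , a₃) (b₁ , b₂ , b₃) = ((a₁ * b₁) + (a₂ * b₂)) + (a₃ * b₃)

  cross : A × A × A → A × A × A → A × A × A
  cross (a₁ , a₂ , a₃) (b₁ , b₂ , b₃) =
    ((a₂ * b₃) + (- (a₃ * b₂)) , (a₃ * b₁) + (- (a₁ * b₃)) , (a₁ * b₂) + (- (a₂ * b₁)))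

module Vectors (R : RealField) where
  open RealField R
  open Geometry R
  open Scalars R
  open CommutativeRing commutativeRing using (zeroˡ; zeroʳ; -‿inverseʳ; +-group)
  open import Algebra.Properties.Group +-group using (∙-cancelˡ; ⁻¹-injective)
  open IsStrictTotalOrder isStrictTotalOrder using (_≟_; _<?_)
  open TripleOps _+_ _*_ -_ public using (_+ᵥ_; _·ᵥ_; cross)
  open module Poly {k : ℕ} = TripleOps {Polynomial k} _:+_ _:*_ :-_ using ()
    renaming (dot to :dot; _−ᵖ_ to _:−ᵖ_; _+ᵥ_ to _:+ᵥ_; _·ᵥ_ to _:·ᵥ_; cross to :cross)
  open ≡-Reasoning

  0ᵥ : Point
  0ᵥ = 0# , 0# , 0#

  _≟ᵖ_ : DecidableEquality Point
  _≟ᵖ_ = ≡-dec _≟_ (≡-dec _≟_ _≟_)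

  componentwise : ∀ {a₁ a₂ a₃ b₁ b₂ b₃ : Carrier} →
                  a₁ ≡ b₁ → a₂ ≡ b₂ → a₃ ≡ b₃ → (a₁ , a₂ , a₃) ≡ (b₁ , b₂ , b₃)
  componentwise refl refl refl = refl

  dot-comm : ∀ x y → dot x y ≡ dot y x
  dot-comm (x₁ , x₂ , x₃) (y₁ , y₂ , y₃) =
    solve 6 (λ x₁ x₂ x₃ y₁ y₂ y₃ → let x = (x₁ , x₂ , x₃) ; y = (y₁ , y₂ , y₃) in
      :dot x y := :dot y x) refl x₁ x₂ x₃ y₁ y₂ y₃

  dot-−ᵖ : ∀ u x y → dot u (x −ᵖ y) ≡ dot u x - dot u y
  dot-−ᵖ (u₁ , u₂ , u₃) (x₁ , x₂ , x₃) (y₁ , y₂ , y₃) =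
    solve 9 (λ u₁ u₂ u₃ x₁ x₂ x₃ y₁ y₂ y₃ →
      let u = (u₁ , u₂ , u₃) ; x = (x₁ , x₂ , x₃) ; y = (y₁ , y₂ , y₃) in
      :dot u (x :−ᵖ y) := :dot u x :- :dot u y) refl u₁ u₂ u₃ x₁ x₂ x₃ y₁ y₂ y₃

  dot-·ᵥ : ∀ k x y → dot (k ·ᵥ x) y ≡ k * dot x y
  dot-·ᵥ k (x₁ , x₂ , x₃) (y₁ , y₂ , y₃) =
    solve 7 (λ k x₁ x₂ x₃ y₁ y₂ y₃ → let x = (x₁ , x₂ , x₃) ; y = (y₁ , y₂ , y₃) in
      :dot (k :·ᵥ x) y := k :* :dot x y) refl k x₁ x₂ x₃ y₁ y₂ y₃

  cross-cross : ∀ x u w → cross x (cross u w) ≡ (dot x w ·ᵥ u) −ᵖ (dot x u ·ᵥ w)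
  cross-cross (x₁ , x₂ , x₃) (u₁ , u₂ , u₃) (w₁ , w₂ , w₃) = componentwise
    (solve 9 (component proj₁) refl x₁ x₂ x₃ u₁ u₂ u₃ w₁ w₂ w₃)
    (solve 9 (component (proj₁ ∘ proj₂)) refl x₁ x₂ x₃ u₁ u₂ u₃ w₁ w₂ w₃)
    (solve 9 (component (proj₂ ∘ proj₂)) refl x₁ x₂ x₃ u₁ u₂ u₃ w₁ w₂ w₃)
    where
    component : ∀ {k} → (Polynomial k × Polynomial k × Polynomial k → Polynomial k) →
                (x₁ x₂ x₃ u₁ u₂ u₃ w₁ w₂ w₃ : Polynomial k) → Polynomial k × Polynomial k
    component π x₁ x₂ x₃ u₁ u₂ u₃ w₁ w₂ w₃ =
      let x = (x₁ , x₂ , x₃) ; u = (u₁ , u₂ , u₃) ; w = (w₁ , w₂ , w₃) in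
      π (:cross x (:cross u w)) := π ((:dot x w :·ᵥ u) :−ᵖ (:dot x u :·ᵥ w))

  thales-difference : ∀ b c c′ d →
    dot (b −ᵖ c′) (d −ᵖ c′) - dot (b −ᵖ c) (d −ᵖ c)
      ≡ dot (c′ −ᵖ c) (c′ −ᵖ c) - dot (c′ −ᵖ c) ((b −ᵖ c) +ᵥ (d −ᵖ c))
  thales-difference (b₁ , b₂ , b₃) (c₁ , c₂ , c₃) (c′₁ , c′₂ , c′₃) (d₁ , d₂ , d₃) =
    solve 12 (λ b₁ b₂ b₃ c₁ c₂ c₃ c′₁ c′₂ c′₃ d₁ d₂ d₃ →
      let b = (b₁ , b₂ , b₃) ; c = (c₁ , c₂ , c₃) ; c′ = (c′₁ , c′₂ , c′₃) ; d = (d₁ , d₂ , d₃) in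
      :dot (b :−ᵖ c′) (d :−ᵖ c′) :- :dot (b :−ᵖ c) (d :−ᵖ c)
        := :dot (c′ :−ᵖ c) (c′ :−ᵖ c) :- :dot (c′ :−ᵖ c) ((b :−ᵖ c) :+ᵥ (d :−ᵖ c)))
      refl b₁ b₂ b₃ c₁ c₂ c₃ c′₁ c′₂ c′₃ d₁ d₂ d₃

  mirror-difference : ∀ n b c c′ d →
    (dot n c + dot n c′) - (dot n b + dot n d)
      ≡ dot n (c′ −ᵖ c) - dot n ((b −ᵖ c) +ᵥ (d −ᵖ c))
  mirror-difference (n₁ , n₂ , n₃) (b₁ , b₂ , b₃) (c₁ , c₂ , c₃) (c′₁ , c′₂ , c′₃) (d₁ , d₂ , d₃) =
    solve 15 (λ n₁ n₂ n₃ b₁ b₂ b₃ c₁ c₂ c₃ c′₁ c′₂ c′₃ d₁ d₂ d₃ →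
      let n = (n₁ , n₂ , n₃) ; b = (b₁ , b₂ , b₃) ; c = (c₁ , c₂ , c₃) ; c′ = (c′₁ , c′₂ , c′₃)
          d = (d₁ , d₂ , d₃) in
      (:dot n c :+ :dot n c′) :- (:dot n b :+ :dot n d)
        := :dot n (c′ :−ᵖ c) :- :dot n ((b :−ᵖ c) :+ᵥ (d :−ᵖ c)))
      refl n₁ n₂ n₃ b₁ b₂ b₃ c₁ c₂ c₃ c′₁ c′₂ c′₃ d₁ d₂ d₃

  ·ᵥ-zeroˡ : ∀ u → 0# ·ᵥ u ≡ 0ᵥ
  ·ᵥ-zeroˡ (u₁ , u₂ , u₃) = componentwise (zeroˡ u₁) (zeroˡ u₂) (zeroˡ u₃)

  ·ᵥ-zeroʳ : ∀ k → k ·ᵥ 0ᵥ ≡ 0ᵥ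
  ·ᵥ-zeroʳ k = componentwise (zeroʳ k) (zeroʳ k) (zeroʳ k)

  x−ᵖx≡0ᵥ : ∀ x → x −ᵖ x ≡ 0ᵥ
  x−ᵖx≡0ᵥ (x₁ , x₂ , x₃) = componentwise (-‿inverseʳ x₁) (-‿inverseʳ x₂) (-‿inverseʳ x₃)

  cross-zeroʳ : ∀ u → cross u 0ᵥ ≡ 0ᵥ
  cross-zeroʳ (u₁ , u₂ , u₃) = componentwise (a0-b0≡0 u₂ u₃) (a0-b0≡0 u₃ u₁) (a0-b0≡0 u₁ u₂)
    where
    a0-b0≡0 : ∀ a b → (a * 0#) - (b * 0#) ≡ 0#
    a0-b0≡0 a b = trans (cong₂ _-_ (zeroʳ a) (zeroʳ b)) (-‿inverseʳ 0#)

  −ᵖ≡0ᵥ⇒≡ : ∀ {x y} → x −ᵖ y ≡ 0ᵥ → x ≡ y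
  −ᵖ≡0ᵥ⇒≡ {x₁ , x₂ , x₃} {y₁ , y₂ , y₃} eq = componentwise
    (x∙y⁻¹≈ε⇒x≈y x₁ y₁ (cong proj₁ eq))
    (x∙y⁻¹≈ε⇒x≈y x₂ y₂ (cong (proj₁ ∘ proj₂) eq))
    (x∙y⁻¹≈ε⇒x≈y x₃ y₃ (cong (proj₂ ∘ proj₂) eq))

  −ᵖ-cancelˡ : ∀ {e d d′} → e −ᵖ d ≡ e −ᵖ d′ → d ≡ d′
  −ᵖ-cancelˡ {e₁ , e₂ , e₃} eq = componentwise
    (⁻¹-injective (∙-cancelˡ e₁ _ _ (cong proj₁ eq)))
    (⁻¹-injective (∙-cancelˡ e₂ _ _ (cong (proj₁ ∘ proj₂) eq)))
    (⁻¹-injective (∙-cancelˡ e₃ _ _ (cong (proj₂ ∘ proj₂) eq)))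

  ·ᵥ-cancelˡ : ∀ {k x y} → ¬ k ≡ 0# → k ·ᵥ x ≡ k ·ᵥ y → x ≡ y
  ·ᵥ-cancelˡ {x = _ , _ , _} {_ , _ , _} k≢0 eq = componentwise
    (*-cancelˡ-≢0 k≢0 (cong proj₁ eq))
    (*-cancelˡ-≢0 k≢0 (cong (proj₁ ∘ proj₂) eq))
    (*-cancelˡ-≢0 k≢0 (cong (proj₂ ∘ proj₂) eq))

  ·ᵥ≡0ᵥ⇒≡0ᵥ : ∀ {k x} → ¬ k ≡ 0# → k ·ᵥ x ≡ 0ᵥ → x ≡ 0ᵥ
  ·ᵥ≡0ᵥ⇒≡0ᵥ {k} k≢0 eq = ·ᵥ-cancelˡ k≢0 (trans eq (sym (·ᵥ-zeroʳ k)))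

  dot-self≡0⇒≡0ᵥ : ∀ {v} → dot v v ≡ 0# → v ≡ 0ᵥ
  dot-self≡0⇒≡0ᵥ {v₁ , v₂ , v₃} vv≡0 = componentwise
    (x*x≡0⇒x≡0 (x+y≡0⇒x≡0 (0≤x*x v₁) (0≤x*x v₂) v₁₂≡0))
    (x*x≡0⇒x≡0 (x+y≡0⇒y≡0 (0≤x*x v₁) (0≤x*x v₂) v₁₂≡0))
    (x*x≡0⇒x≡0 (x+y≡0⇒y≡0 0≤v₁₂ (0≤x*x v₃) vv≡0))
    where
    0≤v₁₂ : 0# ≤ v₁ * v₁ + v₂ * v₂
    0≤v₁₂ = 0≤+ (0≤x*x v₁) (0≤x*x v₂)
    v₁₂≡0 : v₁ * v₁ + v₂ * v₂ ≡ 0#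
    v₁₂≡0 = x+y≡0⇒x≡0 0≤v₁₂ (0≤x*x v₃) vv≡0

  ≢0ᵥ⇒dot-self≢0 : ∀ {v} → ¬ v ≡ 0ᵥ → ¬ dot v v ≡ 0#
  ≢0ᵥ⇒dot-self≢0 v≢0 = v≢0 ∘ dot-self≡0⇒≡0ᵥ

  dot-−ᵖ≡0⇒≡ : ∀ {u x y} → dot u (x −ᵖ y) ≡ 0# → dot u x ≡ dot u y
  dot-−ᵖ≡0⇒≡ {u} {x} {y} eq = x∙y⁻¹≈ε⇒x≈y (dot u x) (dot u y) (trans (sym (dot-−ᵖ u x y)) eq)

  ≡⇒dot-−ᵖ≡0 : ∀ {u x y} → dot u x ≡ dot u y → dot u (x −ᵖ y) ≡ 0#
  ≡⇒dot-−ᵖ≡0 {u} {x} {y} eq = trans (dot-−ᵖ u x y) (x≈y⇒x∙y⁻¹≈ε eq)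

  cross≡0ᵥ⇒∥ : ∀ {v u} → cross v u ≡ 0ᵥ → dot u u ·ᵥ v ≡ dot u v ·ᵥ u
  cross≡0ᵥ⇒∥ {v} {u} v×u≡0 = −ᵖ≡0ᵥ⇒≡ (begin
    (dot u u ·ᵥ v) −ᵖ (dot u v ·ᵥ u)  ≡⟨ cross-cross u v u ⟨
    cross u (cross v u)               ≡⟨ cong (cross u) v×u≡0 ⟩
    cross u 0ᵥ                        ≡⟨ cross-zeroʳ u ⟩
    0ᵥ                                ∎)

  ⊥⊥⇒cross≡0ᵥ : ∀ {x u w} → dot x u ≡ 0# → dot x w ≡ 0# → cross x (cross w u) ≡ 0ᵥ
  ⊥⊥⇒cross≡0ᵥ {x} {u} {w} x·u≡0 x·w≡0 = begin
    cross x (cross w u)               ≡⟨ cross-cross x w u ⟩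
    (dot x u ·ᵥ w) −ᵖ (dot x w ·ᵥ u)  ≡⟨ cong₂ (λ s t → (s ·ᵥ w) −ᵖ (t ·ᵥ u)) x·u≡0 x·w≡0 ⟩
    (0# ·ᵥ w) −ᵖ (0# ·ᵥ u)            ≡⟨ cong₂ _−ᵖ_ (·ᵥ-zeroˡ w) (·ᵥ-zeroˡ u) ⟩
    0ᵥ −ᵖ 0ᵥ                          ≡⟨ x−ᵖx≡0ᵥ 0ᵥ ⟩
    0ᵥ                                ∎

  ⊥-resp-∥ : ∀ {u v x} → ¬ u ≡ 0ᵥ → ¬ v ≡ 0ᵥ → cross v u ≡ 0ᵥ → dot v x ≡ 0# → dot u x ≡ 0#
  ⊥-resp-∥ {u} {v} {x} u≢0 v≢0 v×u≡0 v·x≡0 = x*y≡0⇒y≡0 α≢0 (begin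
    α * dot u x     ≡⟨ dot-·ᵥ α u x ⟨
    dot (α ·ᵥ u) x  ≡⟨ cong (λ y → dot y x) Nv≡αu ⟨
    dot (N ·ᵥ v) x  ≡⟨ dot-·ᵥ N v x ⟩
    N * dot v x     ≡⟨ cong (N *_) v·x≡0 ⟩
    N * 0#          ≡⟨ zeroʳ N ⟩
    0#              ∎)
    where
    N α : Carrier
    N = dot u u
    α = dot u v
    Nv≡αu : N ·ᵥ v ≡ α ·ᵥ u
    Nv≡αu = cross≡0ᵥ⇒∥ v×u≡0
    α≢0 : ¬ α ≡ 0#
    α≢0 α≡0 = v≢0 (·ᵥ≡0ᵥ⇒≡0ᵥ (≢0ᵥ⇒dot-self≢0 u≢0)
      (trans Nv≡αu (trans (cong (_·ᵥ u) α≡0) (·ᵥ-zeroˡ u))))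

  foot-unique : ∀ {u c d d′ e} → ¬ u ≡ 0ᵥ →
    cross (e −ᵖ d) u ≡ 0ᵥ → cross (e −ᵖ d′) u ≡ 0ᵥ → RightAngle c d e → RightAngle c d′ e → d ≡ d′
  foot-unique {u} {c} {d} {d′} {e} u≢0 ∥ ∥′ ∠ ∠′ =
    −ᵖ-cancelˡ (·ᵥ-cancelˡ (≢0ᵥ⇒dot-self≢0 u≢0) (trans (scaled ∥ ∠) (sym (scaled ∥′ ∠′))))
    where
    scaled : ∀ {d} → cross (e −ᵖ d) u ≡ 0ᵥ → RightAngle c d e →
             dot u u ·ᵥ (e −ᵖ d) ≡ (dot u e - dot u c) ·ᵥ u
    scaled {d} ∥ (_ , e≢d , ∠) = begin
      dot u u ·ᵥ (e −ᵖ d)       ≡⟨ cross≡0ᵥ⇒∥ ∥ ⟩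
      dot u (e −ᵖ d) ·ᵥ u       ≡⟨ cong (_·ᵥ u) (dot-−ᵖ u e d) ⟩
      (dot u e - dot u d) ·ᵥ u  ≡⟨ cong (λ z → (dot u e - z) ·ᵥ u) u·d≡u·c ⟩
      (dot u e - dot u c) ·ᵥ u  ∎
      where
      u·d≡u·c : dot u d ≡ dot u c
      u·d≡u·c = sym (dot-−ᵖ≡0⇒≡ (⊥-resp-∥ u≢0 (e≢d ∘ −ᵖ≡0ᵥ⇒≡) ∥ (trans (dot-comm (e −ᵖ d) (c −ᵖ d)) ∠)))

  -- c and c′ lie on a line of direction n and on the sphere with diameter bd, so the chord
  -- c′ − c is parallel to n and its midpoint is level with the centre of the sphere.
  mirror : ∀ {u w b c c′ d} → let n = cross w u in
    ¬ n ≡ 0ᵥ → dot u c ≡ dot u c′ → dot w c ≡ dot w c′ →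
    dot (b −ᵖ c) (d −ᵖ c) ≡ 0# → dot (b −ᵖ c′) (d −ᵖ c′) ≡ 0# → ¬ c ≡ c′ →
    ¬ dot n c ≡ dot n c′ × dot n c + dot n c′ ≡ dot n b + dot n d
  mirror {u} {w} {b} {c} {c′} {d} n≢0 u·c≡u·c′ w·c≡w·c′ ∠ ∠′ c≢c′ =
    (λ n·c≡n·c′ → t≢0 (≡⇒dot-−ᵖ≡0 (sym n·c≡n·c′))) ,
    x∙y⁻¹≈ε⇒x≈y _ _ (trans (mirror-difference n b c c′ d) (x≈y⇒x∙y⁻¹≈ε t≡n·s))
    where
    n δ s : Point
    n = cross w u
    δ = c′ −ᵖ c
    s = (b −ᵖ c) +ᵥ (d −ᵖ c)
    N t : Carrier
    N = dot n n
    t = dot n δ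

    δ⊥ : ∀ {v} → dot v c ≡ dot v c′ → dot δ v ≡ 0#
    δ⊥ {v} v·c≡v·c′ = trans (dot-comm δ v) (≡⇒dot-−ᵖ≡0 (sym v·c≡v·c′))

    Nδ≡tn : N ·ᵥ δ ≡ t ·ᵥ n
    Nδ≡tn = cross≡0ᵥ⇒∥ (⊥⊥⇒cross≡0ᵥ (δ⊥ u·c≡u·c′) (δ⊥ w·c≡w·c′))

    t≢0 : ¬ t ≡ 0#
    t≢0 t≡0 = c≢c′ (sym (−ᵖ≡0ᵥ⇒≡ (·ᵥ≡0ᵥ⇒≡0ᵥ (≢0ᵥ⇒dot-self≢0 n≢0)
      (trans Nδ≡tn (trans (cong (_·ᵥ n) t≡0) (·ᵥ-zeroˡ n))))))

    δ·δ≡δ·s : dot δ δ ≡ dot δ s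
    δ·δ≡δ·s = x∙y⁻¹≈ε⇒x≈y _ _
      (trans (sym (thales-difference b c c′ d)) (trans (cong₂ _-_ ∠′ ∠) (-‿inverseʳ 0#)))

    t≡n·s : t ≡ dot n s
    t≡n·s = *-cancelˡ-≢0 t≢0 (begin
      t * t           ≡⟨ dot-·ᵥ t n δ ⟨
      dot (t ·ᵥ n) δ  ≡⟨ cong (λ y → dot y δ) Nδ≡tn ⟨
      dot (N ·ᵥ δ) δ  ≡⟨ dot-·ᵥ N δ δ ⟩
      N * dot δ δ     ≡⟨ cong (N *_) δ·δ≡δ·s ⟩
      N * dot δ s     ≡⟨ dot-·ᵥ N δ s ⟨
      dot (N ·ᵥ δ) s  ≡⟨ cong (λ y → dot y s) Nδ≡tn ⟩
      dot (t ·ᵥ n) s  ≡⟨ dot-·ᵥ t n s ⟩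
      t * dot n s     ∎)

  BelowMidpoint : Point → Point → Point → Point → Set
  BelowMidpoint n b c d = dot n c + dot n c < dot n b + dot n d

  belowMidpoint? : ∀ n b c d → Dec (BelowMidpoint n b c d)
  belowMidpoint? n b c d = (dot n c + dot n c) <? (dot n b + dot n d)

  parallel-chains-agree : ∀ {a b c d d′ e} →
    RightChain (a ∷ b ∷ c ∷ d ∷ e ∷ []) → RightChain (a ∷ b ∷ c ∷ d′ ∷ e ∷ []) →
    cross (e −ᵖ d) (a −ᵖ b) ≡ 0ᵥ → cross (e −ᵖ d′) (a −ᵖ b) ≡ 0ᵥ → d ≡ d′
  parallel-chains-agree ((a≢b , _) , _ , ∠) (_ , _ , ∠′) ∥ ∥′ =
    foot-unique (a≢b ∘ −ᵖ≡0ᵥ⇒≡) ∥ ∥′ ∠ ∠′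

  skew-chains-opposite : ∀ {a b c c′ d e} → let n = cross (e −ᵖ d) (a −ᵖ b) in
    RightChain (a ∷ b ∷ c ∷ d ∷ e ∷ []) → RightChain (a ∷ b ∷ c′ ∷ d ∷ e ∷ []) →
    ¬ n ≡ 0ᵥ → ¬ c ≡ c′ → BelowMidpoint n b c d ⇔ (¬ BelowMidpoint n b c′ d)
  skew-chains-opposite {a} {b} {c} {c′} {d} {e}
    ((_ , _ , ∠b) , (_ , _ , ∠c) , (_ , _ , ∠d)) ((_ , _ , ∠b′) , (_ , _ , ∠c′) , (_ , _ , ∠d′))
    n≢0 c≢c′ =
      let n·c≢n·c′ , n·c+n·c′≡n·b+n·d = mirror n≢0 u·c≡u·c′ w·c≡w·c′ ∠c ∠c′ c≢c′
      in mirror-below n·c+n·c′≡n·b+n·d n·c≢n·c′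
    where
    u·c≡u·c′ : dot (a −ᵖ b) c ≡ dot (a −ᵖ b) c′
    u·c≡u·c′ = trans (dot-−ᵖ≡0⇒≡ ∠b) (sym (dot-−ᵖ≡0⇒≡ ∠b′))

    w·x≡w·d : ∀ {x} → dot (x −ᵖ d) (e −ᵖ d) ≡ 0# → dot (e −ᵖ d) x ≡ dot (e −ᵖ d) d
    w·x≡w·d {x} ∠ = dot-−ᵖ≡0⇒≡ (trans (dot-comm (e −ᵖ d) (x −ᵖ d)) ∠)

    w·c≡w·c′ : dot (e −ᵖ d) c ≡ dot (e −ᵖ d) c′
    w·c≡w·c′ = trans (w·x≡w·d ∠d) (sym (w·x≡w·d ∠d′))

-- Imported only here: ℕ's _<_, _≤_ and _*_ would clash with the field's in the modules above.
open import Data.Nat using (_<_; _≤_; _*_; _^_)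
open import Data.Fin as Fin using (Fin; combine) renaming (zero to fzero; suc to fsuc)
open import Data.Fin.Properties using (combine-injective; injective⇒≤; suc-injective)
open import Data.List using (List; []; _∷_; length; lookup)
open import Data.List.Membership.Propositional.Properties using (∈-lookup)
open import Data.List.Relation.Unary.All as All using (All)
open import Data.List.Relation.Unary.AllPairs using ([]; _∷_)
open import Data.List.Relation.Unary.Unique.Propositional using (Unique)
open import Data.Product using (∃₂)
open import Function.Definitions using (Injective)

lookup-injective : ∀ {A : Set} {xs : List A} → Unique xs → Injective _≡_ _≡_ (lookup xs)
lookup-injective {xs = _ ∷ _} _          {fzero}  {fzero}  _  = refl
lookup-injective              (x∉xs ∷ _) {fzero}  {fsuc j} eq = contradiction eq (All.lookup x∉xs (∈-lookup j))
lookup-injective              (x∉xs ∷ _) {fsuc i} {fzero}  eq = contradiction (sym eq) (All.lookup x∉xs (∈-lookup i))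
lookup-injective              (_ ∷ xs!)  {fsuc i} {fsuc j} eq = cong fsuc (lookup-injective xs! eq)

injectiveOn⇒length≤ : ∀ {A : Set} {P : A → Set} {m} (f : A → Fin m) →
  (∀ {x y} → P x → P y → f x ≡ f y → x ≡ y) → ∀ {xs} → Unique xs → All P xs → length xs ≤ m
injectiveOn⇒length≤ {P = P} f f-injective {xs} xs! pxs =
  injective⇒≤ (λ eq → lookup-injective xs! (f-injective (P-at _) (P-at _) eq))
  where
  P-at : ∀ i → P (lookup xs i)
  P-at i = All.lookup pxs (∈-lookup i)

toFin : ∀ {n k} → Vec (Fin n) k → Fin (n ^ k)
toFin []       = fzero
toFin (i ∷ is) = combine i (toFin is)

toFin-injective : ∀ {n k} → Injective _≡_ _≡_ (toFin {n} {k})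
toFin-injective {x = []}     {[]}     _  = refl
toFin-injective {x = i ∷ is} {j ∷ js} eq =
  let i≡j , is≡js = combine-injective i (toFin is) j (toFin js) eq
  in cong₂ _∷_ i≡j (toFin-injective is≡js)

encode : ∀ {m n k} → Fin m × Vec (Fin n) k → Fin (m * n ^ k)
encode (i , is) = combine i (toFin is)

encode-injective : ∀ {m n k} → Injective _≡_ _≡_ (encode {m} {n} {k})
encode-injective {x = i , is} {j , js} eq =
  let i≡j , is≡js = combine-injective i (toFin is) j (toFin js) eq
  in cong₂ _,_ i≡j (toFin-injective is≡js)

module Chains (R : RealField) {n : ℕ} (E : Fin n → Geometry.Point R)
              (E-injective : Injective _≡_ _≡_ E) where
  open Geometry R using (Point; RightChain; _−ᵖ_)
  open Vectors R
    using (0ᵥ; cross; _≟ᵖ_; BelowMidpoint; belowMidpoint?; parallel-chains-agree; skew-chains-opposite)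

  Chain : Vec (Fin n) 5 → Set
  Chain t = RightChain (map E t)

  normal : Vec (Fin n) 5 → Point
  normal (i₁ ∷ i₂ ∷ _ ∷ i₄ ∷ i₅ ∷ []) = cross (E i₅ −ᵖ E i₄) (E i₁ −ᵖ E i₂)

  Below : Vec (Fin n) 5 → Set
  Below t@(_ ∷ i₂ ∷ i₃ ∷ i₄ ∷ _ ∷ []) = BelowMidpoint (normal t) (E i₂) (E i₃) (E i₄)

  below? : ∀ t → Dec (Below t)
  below? t@(_ ∷ i₂ ∷ i₃ ∷ i₄ ∷ _ ∷ []) = belowMidpoint? (normal t) (E i₂) (E i₃) (E i₄)

  side : ∀ {P : Set} → Dec P → Fin 2
  side (yes _) = fzero
  side (no _)  = fsuc fzero

  side-≡⇒¬⇔¬ : ∀ {P Q : Set} (p? : Dec P) (q? : Dec Q) → side p? ≡ side q? → ¬ (P ⇔ (¬ Q))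
  side-≡⇒¬⇔¬ (yes p) (yes q) _ p⇔¬q = Equivalence.to p⇔¬q p q
  side-≡⇒¬⇔¬ (no ¬p) (no ¬q) _ p⇔¬q = ¬p (Equivalence.from p⇔¬q ¬q)

  key : (t : Vec (Fin n) 5) → Dec (normal t ≡ 0ᵥ) → Dec (Below t) → Fin 3 × Vec (Fin n) 4
  key (i₁ ∷ i₂ ∷ i₃ ∷ _  ∷ i₅ ∷ []) (yes _) _      = fzero , i₁ ∷ i₂ ∷ i₃ ∷ i₅ ∷ []
  key (i₁ ∷ i₂ ∷ _  ∷ i₄ ∷ i₅ ∷ []) (no _)  below  = fsuc (side below) , i₁ ∷ i₂ ∷ i₄ ∷ i₅ ∷ []

  key-injective : ∀ s t {∥s ∥t <s <t} → Chain s → Chain t → key s ∥s <s ≡ key t ∥t <t → s ≡ t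
  key-injective (i₁ ∷ i₂ ∷ i₃ ∷ _ ∷ i₅ ∷ []) (_ ∷ _ ∷ _ ∷ _ ∷ _ ∷ []) {yes ∥s} {yes ∥t} cs ct refl =
    cong (λ i₄ → i₁ ∷ i₂ ∷ i₃ ∷ i₄ ∷ i₅ ∷ []) (E-injective (parallel-chains-agree cs ct ∥s ∥t))
  key-injective (_ ∷ _ ∷ _ ∷ _ ∷ _ ∷ []) (_ ∷ _ ∷ _ ∷ _ ∷ _ ∷ []) {yes _} {no _} _ _ ()
  key-injective (_ ∷ _ ∷ _ ∷ _ ∷ _ ∷ []) (_ ∷ _ ∷ _ ∷ _ ∷ _ ∷ []) {no _} {yes _} _ _ ()
  key-injective (_ ∷ _ ∷ i₃ ∷ _ ∷ _ ∷ []) (_ ∷ _ ∷ j₃ ∷ _ ∷ _ ∷ []) {no ∦s} {no _} {<s} {<t} cs ct eq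
    with refl ← cong proj₂ eq | i₃ Fin.≟ j₃
  ... | yes refl = refl
  ... | no i₃≢j₃ = ⊥-elim (side-≡⇒¬⇔¬ <s <t (suc-injective (cong proj₁ eq))
                            (skew-chains-opposite cs ct ∦s (i₃≢j₃ ∘ E-injective)))

  code : Vec (Fin n) 5 → Fin (3 * n ^ 4)
  code t = encode (key t (normal t ≟ᵖ 0ᵥ) (below? t))

  code-injective : ∀ {s t} → Chain s → Chain t → code s ≡ code t → s ≡ t
  code-injective {s} {t} cs ct = key-injective s t cs ct ∘ encode-injective

  chains-length≤ : ∀ {L} → Unique L → All Chain L → length L ≤ 3 * n ^ 4
  chains-length≤ = injectiveOn⇒length≤ code code-injective

theorem4p6 : (R : RealField) → let open Geometry R in
    ∃₂ λ (C N : ℕ) → ∀ (n : ℕ) → N < n →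
      (E : Fin n → Point) → Injective _≡_ _≡_ E →
      (L : List (Vec (Fin n) 5)) → Unique L →
      All (λ t → RightChain (map E t)) L →
      length L ≤ C * n ^ 4
theorem4p6 R = 3 , 0 , λ n _ E E-injective L → Chains.chains-length≤ R E E-injective
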